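{- Let $A$ be an MV-algebra with lattice spectrum $X$, prime MV-spectrum $Y$ and map $k\colon X\to Y$ as in the context. For every $y\in Y$, $k^{ -1}({\uparrow}y)=C_y$, where ${\uparrow}y:=\{y'\in Y: y\le y'\}$ and $C_y:=\{x\in X: x+y\text{ is defined and }x+y\le x\}$.
   Context: MV-algebra $(A,\oplus,\neg,0)$: $(A,\oplus,0)$ commutative monoid, $\neg\neg x=x$, $x\oplus\neg0=\neg0$, $\neg(\neg x\oplus y)\oplus y=\neg(\neg y\oplus x)\oplus x$; $1:=\neg0$, $x\ominus y:=\neg(\neg x\oplus y)$; lattice operations $x\vee y:=\neg(\neg x\oplus y)\oplus y$, $x\wedge y:=\neg(\neg x\vee\neg y)$. MV-ideal: downset containing $0$ closed under $\oplus$; prime if proper and for all $a,b$, $a\ominus b$ or $b\ominus a$ lies in it. $X$: set of prime lattice ideals of the lattice reduct, $I_x$ the ideal of $x$, $x\le x'$ iff $I_x\subseteq I_{x'}$. $Y\subseteq X$: points whose ideals are prime MV-ideals. $I\,\overline{\oplus}\,J:=\{c:\exists a\in I,b\in J,\ c\le a\oplus b\}$. For $x,x'\in X$ with $1\notin I_x\,\overline{\oplus}\,I_{x'}$, $x+x'$ is the point with $I_{x+x'}=I_x\,\overline{\oplus}\,I_{x'}$ (a prime lattice ideal); otherwise undefined. $k\colon X\to Y$: $I_{k(x)}$ is the largest lattice ideal $J$ with $I_x\,\overline{\oplus}\,J\subseteq I_x$ (exists, and is a prime MV-ideal). -}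

module Defs where

open import Level using (0ℓ)
open import Data.Product using (Σ; _×_; ∃-syntax; _,_)
open import Data.Sum using (_⊎_)
open import Relation.Nullary using (¬_)
open import Relation.Binary.PropositionalEquality using (_≡_)

record MVAlgebra : Set₁ where
  infixl 6 _⊕_
  field
    Carrier : Set
    _⊕_     : Carrier → Carrier → Carrier
    neg     : Carrier → Carrier
    zero    : Carrier
    ⊕-assoc    : ∀ x y z → (x ⊕ y) ⊕ z ≡ x ⊕ (y ⊕ z)
    ⊕-comm     : ∀ x y → x ⊕ y ≡ y ⊕ x
    ⊕-identity : ∀ x → x ⊕ zero ≡ x
    neg-invol  : ∀ x → neg (neg x) ≡ x
    ⊕-absorb   : ∀ x → x ⊕ neg zero ≡ neg zero
    luk        : ∀ x y → neg (neg x ⊕ y) ⊕ y ≡ neg (neg y ⊕ x) ⊕ x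

  one : Carrier
  one = neg zero

  _⊖_ : Carrier → Carrier → Carrier
  x ⊖ y = neg (neg x ⊕ y)

  _∨_ : Carrier → Carrier → Carrier
  x ∨ y = neg (neg x ⊕ y) ⊕ y

  _∧_ : Carrier → Carrier → Carrier
  x ∧ y = neg (neg x ∨ neg y)

  _≤_ : Carrier → Carrier → Set
  x ≤ y = x ∨ y ≡ y

  Subset : Set₁
  Subset = Carrier → Set

  _⊆_ : Subset → Subset → Set
  I ⊆ J = ∀ a → I a → J a

  record IsLatticeIdeal (I : Subset) : Set where
    field
      zero∈ : I zero
      down  : ∀ a b → a ≤ b → I b → I a
      ∨-closed : ∀ a b → I a → I b → I (a ∨ b)

  record IsPrimeLatticeIdeal (I : Subset) : Set where
    field
      ideal  : IsLatticeIdeal I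
      proper : ¬ I one
      prime  : ∀ a b → I (a ∧ b) → I a ⊎ I b

  record IsMVIdeal (I : Subset) : Set where
    field
      zero∈ : I zero
      down  : ∀ a b → a ≤ b → I b → I a
      ⊕-closed : ∀ a b → I a → I b → I (a ⊕ b)

  record IsPrimeMVIdeal (I : Subset) : Set where
    field
      mvideal : IsMVIdeal I
      proper  : ¬ I one
      prime   : ∀ a b → I (a ⊖ b) ⊎ I (b ⊖ a)

  _⊕̄_ : Subset → Subset → Subset
  (I ⊕̄ J) c = ∃[ a ] ∃[ b ] (I a × J b × c ≤ (a ⊕ b))

  -- Points of X are identified with their prime lattice ideals I_x;
  -- points of Y are those whose ideal is moreover a prime MV-ideal.
  -- x ≤ x' iff I_x ⊆ I_x'.

  -- x + x' is defined iff 1 ∉ I_x ⊕̄ I_x'  (then I_{x+x'} = I_x ⊕̄ I_x')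
  SumDefined : Subset → Subset → Set
  SumDefined I J = ¬ (I ⊕̄ J) one

  -- K is I_{k(x)}: the largest lattice ideal J with I_x ⊕̄ J ⊆ I_x
  IsKOf : Subset → Subset → Set₁
  IsKOf Ix K =
    (IsLatticeIdeal K × ((Ix ⊕̄ K) ⊆ Ix)) ×
    (∀ (J : Subset) → IsLatticeIdeal J → (Ix ⊕̄ J) ⊆ Ix → J ⊆ K)

module Submission where

open import Defs
open import Data.Product using (_×_; _,_)
open import Function.Bundles using (_⇔_; mk⇔)
open import Relation.Nullary using (¬_)

-- k(x) is the largest ideal absorbed by x under ⊕̄, so y ≤ k(x) says exactly
-- that y is absorbed, i.e. x + y ≤ x; definedness of x + y is then automatic,
-- since 1 ∉ I_x.

module _ (A : MVAlgebra) where
  open MVAlgebra A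

  ⊕̄-monoʳ : {I J J′ : Subset} → J ⊆ J′ → (I ⊕̄ J) ⊆ (I ⊕̄ J′)
  ⊕̄-monoʳ J⊆J′ c (a , b , a∈I , b∈J , c≤a⊕b) = a , b , a∈I , J⊆J′ b b∈J , c≤a⊕b

  absorbed⇒sumDefined : {I J : Subset} → ¬ I one → (I ⊕̄ J) ⊆ I → SumDefined I J
  absorbed⇒sumDefined one∉I I⊕̄J⊆I one∈I⊕̄J = one∉I (I⊕̄J⊆I one one∈I⊕̄J)

proposition7p6 : (A : MVAlgebra) → let open MVAlgebra A in
    (Iy : Subset) → IsPrimeLatticeIdeal Iy → IsPrimeMVIdeal Iy →
    (Ix : Subset) → IsPrimeLatticeIdeal Ix →
    (Kx : Subset) → IsKOf Ix Kx →
    (Iy ⊆ Kx) ⇔ (SumDefined Ix Iy × ((Ix ⊕̄ Iy) ⊆ Ix))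
proposition7p6 A Iy Iy-prime _ Ix Ix-prime Kx ((_ , Ix⊕̄Kx⊆Ix) , Kx-largest) =
  mk⇔ to from
  where
  open MVAlgebra A

  to : Iy ⊆ Kx → SumDefined Ix Iy × ((Ix ⊕̄ Iy) ⊆ Ix)
  to Iy⊆Kx = absorbed⇒sumDefined A (IsPrimeLatticeIdeal.proper Ix-prime) absorbed
           , absorbed
    where
    absorbed : (Ix ⊕̄ Iy) ⊆ Ix
    absorbed c c∈Ix⊕̄Iy = Ix⊕̄Kx⊆Ix c (⊕̄-monoʳ A Iy⊆Kx c c∈Ix⊕̄Iy)

  from : SumDefined Ix Iy × ((Ix ⊕̄ Iy) ⊆ Ix) → Iy ⊆ Kx
  from (_ , absorbed) = Kx-largest Iy (IsPrimeLatticeIdeal.ideal Iy-prime) absorbed
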